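{- Let $\mathcal{C}\subseteq\mathbb{F}_q^{k\times m}$ be an MRD code with $|\mathcal{C}|\ge 2$. Then $\rho(\mathcal{C})\le d(\mathcal{C})-1$, with equality if and only if $\mu(\mathcal{C})=1$.
   Context: $q$ prime power, $k\le m$ positive integers. Rank distance $d(M,N)=\mathrm{rk}(M-N)$; a code is a non-empty subset of $\mathbb{F}_q^{k\times m}$, $d(\mathcal{C})$ its minimum distance (when $|\mathcal{C}|\ge2$), $\rho(\mathcal{C})=\min\{i:\forall X\ \exists M\in\mathcal{C},\ d(X,M)\le i\}$ its covering radius. $\mathcal{C}$ is MRD if $|\mathcal{C}|=1$ or $|\mathcal{C}|\ge2$ and $\log_q|\mathcal{C}| = m(k-d(\mathcal{C})+1)$. For $|\mathcal{C}|\ge2$ the maximality degree is $\mu(\mathcal{C})=\min\{d(\mathcal{C})-d(\mathcal{D}):\mathcal{D}\supsetneq\mathcal{C} \text{ a code in } \mathbb{F}_q^{k\times m}\}$ if $\mathcal{C}\ne\mathbb{F}_q^{k\times m}$, and $\mu(\mathcal{C})=1$ otherwise. -}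

module Defs where

open import Level using (0ℓ)
open import Data.Nat using (ℕ; zero; suc; _+_; _*_; _∸_; _^_; _≤_)
open import Data.Nat.Primality using (Prime)
open import Data.Fin using (Fin) renaming (zero to fzero; suc to fsuc)
open import Data.Vec using (Vec; []; _∷_; zipWith; map; replicate; lookup)
open import Data.List using (List; length)
open import Data.List.Membership.Propositional using (_∈_; _∉_)
open import Data.List.Relation.Unary.Unique.Propositional using (Unique)
open import Data.Product using (Σ; ∃; ∃-syntax; _×_; _,_)
open import Function.Definitions using (Injective)
open import Relation.Binary.PropositionalEquality using (_≡_; _≢_)
open import Relation.Nullary using (¬_)
open import Algebra.Core using (Op₁; Op₂)
import Algebra.Structures as AS

-- A finite field with q elements, presented (up to isomorphism) as a field
-- structure on the carrier Fin q, with propositional equality.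
record FiniteField (q : ℕ) : Set where
  field
    _+F_ _*F_ : Op₂ (Fin q)
    -F_       : Op₁ (Fin q)
    0F 1F     : Fin q
    isCommutativeRing : AS.IsCommutativeRing {A = Fin q} _≡_ _+F_ _*F_ -F_ 0F 1F
    0≢1       : 0F ≢ 1F
    inverse   : ∀ x → x ≢ 0F → ∃[ y ] (x *F y ≡ 1F)

IsPrimePower : ℕ → Set
IsPrimePower q = ∃[ p ] ∃[ e ] (Prime p × q ≡ p ^ suc e)

module RankMetric {q : ℕ} (F : FiniteField q) (k m : ℕ) where
  open FiniteField F

  Row : Set
  Row = Vec (Fin q) m

  Mat : Set
  Mat = Vec Row k

  _-M_ : Mat → Mat → Mat
  M -M N = zipWith (zipWith (λ a b → a +F (-F b))) M N

  zeroRow : Row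
  zeroRow = replicate m 0F

  _+R_ : Row → Row → Row
  _+R_ = zipWith _+F_

  _·R_ : Fin q → Row → Row
  c ·R v = map (c *F_) v

  lincomb : ∀ {r} → (Fin r → Fin q) → (Fin r → Row) → Row
  lincomb {zero}  c v = zeroRow
  lincomb {suc r} c v = (c fzero ·R v fzero) +R lincomb (λ i → c (fsuc i)) (λ i → v (fsuc i))

  LinIndep : ∀ {r} → (Fin r → Row) → Set
  LinIndep {r} v = ∀ (c : Fin r → Fin q) → lincomb c v ≡ zeroRow → ∀ i → c i ≡ 0F

  RankAtLeast : Mat → ℕ → Set
  RankAtLeast M r = ∃[ f ] (Injective _≡_ _≡_ f × LinIndep (λ (i : Fin r) → lookup M (f i)))

  IsRank : Mat → ℕ → Set
  IsRank M r = RankAtLeast M r × ¬ RankAtLeast M (suc r)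

  DistAtMost : Mat → Mat → ℕ → Set
  DistAtMost M N i = ¬ RankAtLeast (M -M N) (suc i)

  -- a code: a non-empty finite set of matrices, listed without repetition
  IsCode : List Mat → Set
  IsCode C = Unique C × 1 ≤ length C

  MinDist : List Mat → ℕ → Set
  MinDist C d =
    (∃[ M ] ∃[ N ] (M ∈ C × N ∈ C × M ≢ N × IsRank (M -M N) d)) ×
    (∀ M N → M ∈ C → N ∈ C → M ≢ N → RankAtLeast (M -M N) d)

  Covers : List Mat → ℕ → Set
  Covers C i = ∀ (X : Mat) → ∃[ M ] (M ∈ C × DistAtMost X M i)

  CovRadius : List Mat → ℕ → Set
  CovRadius C ρ = Covers C ρ × (∀ i → Covers C i → ρ ≤ i)

  IsMRD≥2 : List Mat → Set
  IsMRD≥2 C = 2 ≤ length C × ∀ d → MinDist C d → length C ≡ q ^ (m * (k ∸ d + 1))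

  IsWholeSpace : List Mat → Set
  IsWholeSpace C = ∀ X → X ∈ C

  StrictSuper : List Mat → List Mat → Set
  StrictSuper D C = IsCode D × (∀ X → X ∈ C → X ∈ D) × ∃[ X ] (X ∈ D × X ∉ C)

  MaxDeg : List Mat → ℕ → Set
  MaxDeg C μ =
    (IsWholeSpace C → μ ≡ 1) ×
    (¬ IsWholeSpace C →
       ∀ dC → MinDist C dC →
         (∃[ D ] ∃[ dD ] (StrictSuper D C × MinDist D dD × μ ≡ dC ∸ dD)) ×
         (∀ D dD → StrictSuper D C → MinDist D dD → μ ≤ dC ∸ dD))

module Submission where

-- Let C ⊆ F_q^{k×m} be MRD with minimum distance d = d′ + 1.  Reading off the
-- last k − d′ rows of a matrix is injective on C (two codewords agreeing there
-- differ in at most d′ rows, so their distance is ≤ d′ < d), and |C| equals the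
-- number (q^m)^(k−d′) of possible row blocks.  Hence this map is a bijection
-- from C onto all row blocks: every X agrees on its last k − d′ rows with some
-- codeword, which therefore lies at distance ≤ d′ from X.  This gives ρ ≤ d − 1,
-- and also that any strictly larger code has minimum distance ≤ d − 1.
--
-- The equivalence then follows:  ρ = d − 1 produces a word at distance ≥ d − 1
-- from all of C, and adjoining it yields a code of distance exactly d − 1, so
-- μ = 1;  conversely μ = 1 gives a superset of distance d − 1, whose new word
-- is at distance ≥ d − 1 from C, so ρ ≥ d − 1.
--
-- Statements that are classically immediate but not constructively (picking an
-- uncovered word) are proved under ¬¬, which suffices as the goals are decidable.

open import Defs
open import Level using (0ℓ)
open import Data.Nat as ℕ using (ℕ; zero; suc; _+_; _*_; _∸_; _^_; _≤_; _<_; z≤n; s≤s; _≤′_; ≤′-refl; ≤′-step)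
import Data.Nat.Properties as ℕP
open import Data.Fin using (Fin; toℕ; fromℕ<; funToFin; finToFun) renaming (zero to fzero; suc to fsuc)
import Data.Fin.Properties as FinP
open import Data.Vec as Vec using (Vec; []; _∷_; zipWith; map; replicate; lookup; tabulate)
import Data.Vec.Properties as VecP
open import Data.List as List using (List; length) renaming (_∷_ to _∷ₗ_)
open import Data.List.Membership.Propositional using (_∈_; _∉_; find)
open import Data.List.Membership.Propositional.Properties using (∈-lookup)
open import Data.List.Relation.Unary.Any as Any using (here; there)
import Data.List.Relation.Unary.All as All
open import Data.List.Relation.Unary.AllPairs using (_∷_)
open import Data.List.Relation.Unary.Unique.Propositional using (Unique)
open import Data.Product using (∃-syntax; _×_; _,_; proj₁; proj₂)
open import Data.Empty using (⊥-elim)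
open import Function using (_∘_)
open import Function.Bundles using (_⇔_; mk⇔)
open import Function.Definitions using (Injective)
open import Relation.Nullary using (¬_; Dec; yes; no)
open import Relation.Nullary.Negation using (¬¬-map)
open import Relation.Nullary.Decidable using (decidable-stable; ¬¬-excluded-middle)
open import Relation.Binary.PropositionalEquality
open import Algebra.Bundles using (CommutativeRing)
import Algebra.Properties.Ring as RingProperties

module Counting {A : Set} where

  InjectiveOn : ∀ {N} → (A → Fin N) → List A → Set
  InjectiveOn g xs = ∀ {x y} → x ∈ xs → y ∈ xs → g x ≡ g y → x ≡ y

  unique-lookup-injective : ∀ {xs : List A} → Unique xs → Injective _≡_ _≡_ (List.lookup xs)
  unique-lookup-injective {_ ∷ₗ _} (_  ∷ _) {fzero}  {fzero}  _ = refl
  unique-lookup-injective {_ ∷ₗ _} (x∉ ∷ _) {fzero}  {fsuc j} e = ⊥-elim (All.lookup x∉ (∈-lookup j) e)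
  unique-lookup-injective {_ ∷ₗ _} (x∉ ∷ _) {fsuc i} {fzero}  e = ⊥-elim (All.lookup x∉ (∈-lookup i) (sym e))
  unique-lookup-injective {_ ∷ₗ _} (_  ∷ u) {fsuc i} {fsuc j} e = cong fsuc (unique-lookup-injective u e)

  length≤ : ∀ {N} {xs : List A} (g : A → Fin N) → Unique xs → InjectiveOn g xs → length xs ≤ N
  length≤ g u g-inj =
    FinP.injective⇒≤ (λ e → unique-lookup-injective u (g-inj (∈-lookup _) (∈-lookup _) e))

  -- If moreover the list has exactly N entries, g takes every value on it:
  -- otherwise x could be added to the list, giving N + 1 entries.
  full⇒onto : ∀ {N} {xs : List A} (g : A → Fin N) → Unique xs → InjectiveOn g xs →
    length xs ≡ N → ∀ x → ∃[ y ] (y ∈ xs × g y ≡ g x)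
  full⇒onto {xs = xs} g u g-inj len x with Any.any? (λ y → g y FinP.≟ g x) xs
  ... | yes hit = find hit
  ... | no miss = ⊥-elim (ℕP.<-irrefl len (length≤ g (All.tabulate x≢ ∷ u) g-inj′))
    where
      x≢ : ∀ {y} → y ∈ xs → x ≢ y
      x≢ y∈ refl = miss (Any.map (λ { refl → refl }) y∈)
      g-inj′ : InjectiveOn g (x ∷ₗ xs)
      g-inj′ (here refl) (here refl) _ = refl
      g-inj′ (here refl) (there y∈) e = ⊥-elim (miss (Any.map (λ { refl → sym e }) y∈))
      g-inj′ (there x∈) (here refl) e = ⊥-elim (miss (Any.map (λ { refl → e }) x∈))
      g-inj′ (there x∈) (there y∈) e = g-inj x∈ y∈ e

-- The double-negation shift  (∀ x. ¬¬ P x) → ¬¬ (∀ x. P x)  holds on finite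
-- domains; it is what lets us extract an uncovered word from ¬ (C covers).
DNShift : Set → Set₁
DNShift A = (P : A → Set) → (∀ x → ¬ ¬ P x) → ¬ ¬ (∀ x → P x)

dnshift-Fin : ∀ n → DNShift (Fin n)
dnshift-Fin zero    P h k = k (λ ())
dnshift-Fin (suc n) P h k =
  h fzero λ p₀ → dnshift-Fin n (P ∘ fsuc) (h ∘ fsuc) λ pₛ → k λ { fzero → p₀ ; (fsuc i) → pₛ i }

dnshift-Vec : ∀ {A} → DNShift A → ∀ n → DNShift (Vec A n)
dnshift-Vec shiftA zero    P h k = h [] λ p → k λ { [] → p }
dnshift-Vec shiftA (suc n) P h k =
  shiftA (λ a → ∀ v → P (a ∷ v)) (λ a → dnshift-Vec shiftA n (P ∘ (a ∷_)) (h ∘ (a ∷_)))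
    λ all → k λ { (a ∷ v) → all a v }

funToFin-injective : ∀ {m n} (f g : Fin m → Fin n) → funToFin f ≡ funToFin g → ∀ i → f i ≡ g i
funToFin-injective f g e i = begin
  f i                      ≡⟨ FinP.finToFun-funToFin f i ⟨
  finToFun (funToFin f) i  ≡⟨ cong (λ c → finToFun c i) e ⟩
  finToFun (funToFin g) i  ≡⟨ FinP.finToFun-funToFin g i ⟩
  g i                      ∎
  where open ≡-Reasoning

vec-ext : ∀ {A : Set} {n} (u v : Vec A n) → (∀ i → lookup u i ≡ lookup v i) → u ≡ v
vec-ext u v h = begin
  u                   ≡⟨ VecP.tabulate∘lookup u ⟨
  tabulate (lookup u) ≡⟨ VecP.tabulate-cong h ⟩
  tabulate (lookup v) ≡⟨ VecP.tabulate∘lookup v ⟩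
  v                   ∎
  where open ≡-Reasoning

module Rank {q : ℕ} (F : FiniteField q) (k m : ℕ) where
  open FiniteField F
  open RankMetric F k m

  private
    ring : CommutativeRing 0ℓ 0ℓ
    ring = record { isCommutativeRing = isCommutativeRing }
  open CommutativeRing ring using (+-identityˡ; zeroˡ; zeroʳ; -‿inverseʳ) renaming (ring to ringR)
  open RingProperties ringR using (⁻¹-anti-homo‿-; -‿distribˡ-*; -‿distribʳ-*; -‿injective; -0#≈0#)

  _⊖_ : Fin q → Fin q → Fin q
  a ⊖ b = a +F (-F b)

  AgreeFrom : ℕ → Mat → Mat → Set
  AgreeFrom s X Y = ∀ i → s ≤ toℕ i → lookup X i ≡ lookup Y i

  Separated : List Mat → ℕ → Set
  Separated D r = ∀ M N → M ∈ D → N ∈ D → M ≢ N → RankAtLeast (M -M N) r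

  _≟M_ : (X Y : Mat) → Dec (X ≡ Y)
  _≟M_ = VecP.≡-dec (VecP.≡-dec FinP._≟_)

  zero+zero : ∀ {n} → zipWith _+F_ (replicate n 0F) (replicate n 0F) ≡ replicate n 0F
  zero+zero {zero}  = refl
  zero+zero {suc n} = cong₂ _∷_ (+-identityˡ 0F) zero+zero

  lincomb-zero : ∀ {r} (c : Fin r → Fin q) (v : Fin r → Row) →
    (∀ j → c j ·R v j ≡ zeroRow) → lincomb c v ≡ zeroRow
  lincomb-zero {zero}  c v h = refl
  lincomb-zero {suc r} c v h =
    trans (cong₂ _+R_ (h fzero) (lincomb-zero (c ∘ fsuc) (v ∘ fsuc) (h ∘ fsuc))) zero+zero

  zero·R : ∀ {n} (v : Vec (Fin q) n) → map (0F *F_) v ≡ replicate n 0F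
  zero·R []      = refl
  zero·R (a ∷ v) = cong₂ _∷_ (zeroˡ a) (zero·R v)

  ·Rzero : ∀ {n} c → map (c *F_) (replicate n 0F) ≡ replicate n 0F
  ·Rzero {zero}  c = refl
  ·Rzero {suc n} c = cong₂ _∷_ (zeroʳ c) (·Rzero c)

  lincomb-neg : ∀ {r} (c : Fin r → Fin q) (v w : Fin r → Row) →
    (∀ j → w j ≡ map -F_ (v j)) → lincomb c w ≡ lincomb (λ j → -F c j) v
  lincomb-neg {zero}  c v w h = refl
  lincomb-neg {suc r} c v w h =
    cong₂ _+R_ (trans (cong (c fzero ·R_) (h fzero)) (scale-neg (c fzero) (v fzero)))
               (lincomb-neg (c ∘ fsuc) (v ∘ fsuc) (w ∘ fsuc) (h ∘ fsuc))
    where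
      scale-neg : ∀ {n} c (u : Vec (Fin q) n) → map (c *F_) (map -F_ u) ≡ map ((-F c) *F_) u
      scale-neg c []      = refl
      scale-neg c (a ∷ u) = cong₂ _∷_ (trans (sym (-‿distribʳ-* c a)) (-‿distribˡ-* c a)) (scale-neg c u)

  -- An independent family contains no zero vector (coefficient 1 on it, 0 elsewhere).
  independent⇒nonzero : ∀ {r} {v : Fin r → Row} → LinIndep v → ∀ i → v i ≢ zeroRow
  independent⇒nonzero {v = v} indep i vᵢ≡0 = 0≢1 (sym (trans (sym (δ-self i)) (indep (δ i) δ-comb i)))
    where
      δ : Fin _ → Fin _ → Fin q
      δ p j with j FinP.≟ p
      ... | yes _ = 1F
      ... | no  _ = 0F
      δ-self : ∀ p → δ p p ≡ 1F
      δ-self p with p FinP.≟ p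
      ... | yes _ = refl
      ... | no p≢p = ⊥-elim (p≢p refl)
      δ-term : ∀ j → δ i j ·R v j ≡ zeroRow
      δ-term j with j FinP.≟ i
      ... | yes refl = trans (cong (1F ·R_) vᵢ≡0) (·Rzero 1F)
      ... | no  _    = zero·R (v j)
      δ-comb : lincomb (δ i) v ≡ zeroRow
      δ-comb = lincomb-zero (δ i) v δ-term

  rank≤k : ∀ A r → RankAtLeast A r → r ≤ k
  rank≤k A r (f , f-inj , _) = FinP.injective⇒≤ f-inj

  -- Rank is downward closed: drop the first chosen row.
  rank-pred : ∀ A r → RankAtLeast A (suc r) → RankAtLeast A r
  rank-pred A r (f , f-inj , indep) = f ∘ fsuc , FinP.suc-injective ∘ f-inj , indep′
    where
      indep′ : LinIndep (λ i → lookup A (f (fsuc i)))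
      indep′ c comb≡0 i = indep (λ { fzero → 0F ; (fsuc j) → c j }) comb′≡0 (fsuc i)
        where
          comb′≡0 : lincomb (λ { fzero → 0F ; (fsuc j) → c j }) (λ i → lookup A (f i)) ≡ zeroRow
          comb′≡0 = trans (cong₂ _+R_ (zero·R (lookup A (f fzero))) comb≡0) zero+zero

  rank-mono : ∀ A {r r′} → r′ ≤′ r → RankAtLeast A r → RankAtLeast A r′
  rank-mono A ≤′-refl          h = h
  rank-mono A (≤′-step {r} r′≤r) h = rank-mono A r′≤r (rank-pred A r h)

  -- Rank distance is symmetric: M − X is the row-wise negation of X − M.
  rank-sym : ∀ X M r → RankAtLeast (X -M M) r → RankAtLeast (M -M X) r
  rank-sym X M r (f , f-inj , indep) = f , f-inj , indep′
    where
      swap-row : ∀ {n} (u v : Vec (Fin q) n) → zipWith _⊖_ v u ≡ map -F_ (zipWith _⊖_ u v)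
      swap-row []      []      = refl
      swap-row (a ∷ u) (b ∷ v) = cong₂ _∷_ (sym (⁻¹-anti-homo‿- a b)) (swap-row u v)
      swap : ∀ i → lookup (M -M X) i ≡ map -F_ (lookup (X -M M) i)
      swap i = begin
        lookup (M -M X) i                                ≡⟨ VecP.lookup-zipWith _ i M X ⟩
        zipWith _⊖_ (lookup M i) (lookup X i)            ≡⟨ swap-row (lookup X i) (lookup M i) ⟩
        map -F_ (zipWith _⊖_ (lookup X i) (lookup M i))  ≡⟨ cong (map -F_) (VecP.lookup-zipWith _ i X M) ⟨
        map -F_ (lookup (X -M M) i)                      ∎
        where open ≡-Reasoning
      indep′ : LinIndep (λ j → lookup (M -M X) (f j))
      indep′ c comb≡0 i = -‿injective (trans (indep (λ j → -F c j) neg-comb≡0 i) (sym -0#≈0#))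
        where
          neg-comb≡0 : lincomb (λ j → -F c j) (λ j → lookup (X -M M) (f j)) ≡ zeroRow
          neg-comb≡0 = trans (sym (lincomb-neg c _ _ (swap ∘ f))) comb≡0

  agree⇒zero-rows : ∀ s X M → AgreeFrom s X M → ∀ i → s ≤ toℕ i → lookup (X -M M) i ≡ zeroRow
  agree⇒zero-rows s X M agree i s≤i = begin
    lookup (X -M M) i                       ≡⟨ VecP.lookup-zipWith _ i X M ⟩
    zipWith _⊖_ (lookup X i) (lookup M i)   ≡⟨ cong (λ row → zipWith _⊖_ row (lookup M i)) (agree i s≤i) ⟩
    zipWith _⊖_ (lookup M i) (lookup M i)   ≡⟨ self-diff (lookup M i) ⟩
    zeroRow                                 ∎
    where
      open ≡-Reasoning
      self-diff : ∀ {n} (u : Vec (Fin q) n) → zipWith _⊖_ u u ≡ replicate n 0F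
      self-diff []      = refl
      self-diff (a ∷ u) = cong₂ _∷_ (-‿inverseʳ a) (self-diff u)

  -- If all rows from index s on vanish, at most s rows are independent:
  -- the chosen independent rows are nonzero, so they all have index < s.
  zero-rows⇒rank≤ : ∀ A s r → (∀ i → s ≤ toℕ i → lookup A i ≡ zeroRow) → RankAtLeast A r → r ≤ s
  zero-rows⇒rank≤ A s r zero-rows (f , f-inj , indep) = FinP.injective⇒≤ g-inj
    where
      below : ∀ j → toℕ (f j) < s
      below j = ℕP.≰⇒> (λ s≤fj → independent⇒nonzero indep j (zero-rows (f j) s≤fj))
      g : Fin r → Fin s
      g j = fromℕ< (below j)
      g-inj : Injective _≡_ _≡_ g
      g-inj {x} {y} e = f-inj (FinP.toℕ-injective (begin
        toℕ (f x)  ≡⟨ FinP.toℕ-fromℕ< (below x) ⟨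
        toℕ (g x)  ≡⟨ cong toℕ e ⟩
        toℕ (g y)  ≡⟨ FinP.toℕ-fromℕ< (below y) ⟩
        toℕ (f y)  ∎))
        where open ≡-Reasoning

  agree⇒rank≤ : ∀ s X M r → AgreeFrom s X M → RankAtLeast (X -M M) r → r ≤ s
  agree⇒rank≤ s X M r agree = zero-rows⇒rank≤ (X -M M) s r (agree⇒zero-rows s X M agree)

  agree⇒close : ∀ s X M → AgreeFrom s X M → DistAtMost X M s
  agree⇒close s X M agree h = ℕP.1+n≰n (agree⇒rank≤ s X M (suc s) agree h)

  -- The block of rows s, …, k − 1 of a matrix, encoded as a number below
  -- (q^m)^(k−s); equal codes mean agreement from row s on.
  module TailCode (s : ℕ) (s≤k : s ≤ k) where
    tailRow : Fin (k ∸ s) → Fin k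
    tailRow j = fromℕ< (subst (s + toℕ j <_) (ℕP.m+[n∸m]≡n s≤k) (ℕP.+-monoʳ-< s (FinP.toℕ<n j)))

    tailCode : Mat → Fin ((q ^ m) ^ (k ∸ s))
    tailCode X = funToFin (λ j → funToFin (lookup (lookup X (tailRow j))))

    tailRow-onto : ∀ i → s ≤ toℕ i → ∃[ j ] (tailRow j ≡ i)
    tailRow-onto i s≤i = j , FinP.toℕ-injective (begin
        toℕ (tailRow j)        ≡⟨ FinP.toℕ-fromℕ< _ ⟩
        s + toℕ j              ≡⟨ cong (s +_) (FinP.toℕ-fromℕ< i∸s<k∸s) ⟩
        s + (toℕ i ∸ s)        ≡⟨ ℕP.m+[n∸m]≡n s≤i ⟩
        toℕ i                  ∎)
      where
        open ≡-Reasoning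
        i∸s<k∸s : toℕ i ∸ s < k ∸ s
        i∸s<k∸s = ℕP.∸-monoˡ-< (FinP.toℕ<n i) s≤i
        j : Fin (k ∸ s)
        j = fromℕ< i∸s<k∸s

    tailCode-agree : ∀ X Y → tailCode X ≡ tailCode Y → AgreeFrom s X Y
    tailCode-agree X Y e i s≤i with tailRow-onto i s≤i
    ... | j , refl = vec-ext _ _ (funToFin-injective _ _ (funToFin-injective _ _ e j))

  flip-first-entry : ∀ {n l} → 1 ≤ n → 1 ≤ l → (X : Vec (Vec (Fin q) l) n) →
    ∃[ Y ] (Y ≢ X × (∀ i → 1 ≤ toℕ i → lookup Y i ≡ lookup X i))
  flip-first-entry {suc _} {suc _} _ _ ((a ∷ row) ∷ rows) =
    ((other a ∷ row) ∷ rows) , (λ e → other≢ a (cong (Vec.head ∘ Vec.head) e)) , λ { (fsuc i) _ → refl }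
    where
      other : Fin q → Fin q
      other a with a FinP.≟ 0F
      ... | yes _ = 1F
      ... | no  _ = 0F
      other≢ : ∀ a → other a ≢ a
      other≢ a with a FinP.≟ 0F
      ... | yes a≡0 = λ 1≡a → 0≢1 (sym (trans 1≡a a≡0))
      ... | no  a≢0 = λ 0≡a → a≢0 (sym 0≡a)

  dnshift-Mat : DNShift Mat
  dnshift-Mat = dnshift-Vec (dnshift-Vec (dnshift-Fin q) m) k

  2≤q : 2 ≤ q
  2≤q = FinP.injective⇒≤ pick-injective
    where
      pick : Fin 2 → Fin q
      pick fzero    = 0F
      pick (fsuc _) = 1F
      pick-injective : Injective _≡_ _≡_ pick
      pick-injective {fzero}      {fzero}      _ = refl
      pick-injective {fzero}      {fsuc fzero} e = ⊥-elim (0≢1 e)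
      pick-injective {fsuc fzero} {fzero}      e = ⊥-elim (0≢1 (sym e))
      pick-injective {fsuc fzero} {fsuc fzero} _ = refl

  FarFrom : List Mat → Mat → ℕ → Set
  FarFrom C X r = ∀ M → M ∈ C → RankAtLeast (X -M M) r

  far⇒≤radius : ∀ C X r ρ → FarFrom C X r → Covers C ρ → r ≤ ρ
  far⇒≤radius C X r ρ far covers with covers X
  ... | M , M∈C , close = ℕP.≮⇒≥ (λ ρ<r → close (rank-mono (X -M M) (ℕP.≤⇒≤′ ρ<r) (far M M∈C)))

  -- If C does not cover at radius r, some word is (not-not) at distance
  -- ≥ r + 1 from all of C.  This is where finiteness of the space is used.
  uncovered-word : ∀ C r → ¬ Covers C r → ¬ ¬ (∃[ X ] FarFrom C X (suc r))
  uncovered-word C r ¬covers no-far = dnshift-Mat _ covered ¬covers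
    where
      covered : ∀ X → ¬ ¬ (∃[ M ] (M ∈ C × DistAtMost X M r))
      covered X ¬close = dnshift-Mat _ far-from-each (λ far → no-far (X , λ M → far M))
        where
          far-from-each : ∀ M → ¬ ¬ (M ∈ C → RankAtLeast (X -M M) (suc r))
          far-from-each M ¬far = ¬far (λ M∈C → ⊥-elim (¬close (M , M∈C , λ h → ¬far (λ _ → h))))

  adjoin-far : ∀ C X r → Separated C r → FarFrom C X r → Separated (X ∷ₗ C) r
  adjoin-far C X r sep far A B (here refl) (here refl) A≢B = ⊥-elim (A≢B refl)
  adjoin-far C X r sep far A B (here refl) (there B∈) _   = far B B∈
  adjoin-far C X r sep far A B (there A∈) (here refl) _   = rank-sym X A r (far A A∈)
  adjoin-far C X r sep far A B (there A∈) (there B∈) A≢B = sep A B A∈ B∈ A≢B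

  code-size≤ : ∀ C → Unique C → length C ≤ (q ^ m) ^ k
  code-size≤ C uC = Counting.length≤ tailCode uC (λ {X} {Y} _ _ e → vec-ext X Y (λ i → tailCode-agree X Y e i z≤n))
    where open TailCode 0 z≤n

  -- An MRD code with at least two words has positive minimum distance:
  -- distance 0 would give it q^(m(k+1)) words, more than there are matrices.
  MRD-distance-positive : 1 ≤ m → ∀ C → IsCode C → IsMRD≥2 C → ¬ MinDist C 0
  MRD-distance-positive 1≤m C (uC , _) (_ , mrd) md = ℕP.<⇒≱ too-many (code-size≤ C uC)
    where
      open ℕP.≤-Reasoning
      too-many : (q ^ m) ^ k < length C
      too-many = begin-strict
        (q ^ m) ^ k        ≡⟨ ℕP.^-*-assoc q m k ⟩
        q ^ (m * k)        <⟨ ℕP.^-monoʳ-< q 2≤q (ℕP.*-monoʳ-< m {{ℕ.>-nonZero 1≤m}} (ℕP.m<m+n k (s≤s z≤n))) ⟩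
        q ^ (m * (k + 1))  ≡⟨ mrd 0 md ⟨
        length C           ∎

  module MRD (C : List Mat) (uC : Unique C) (mrd : ∀ d → MinDist C d → length C ≡ q ^ (m * (k ∸ d + 1)))
             (d′ : ℕ) (md : MinDist C (suc d′)) where

    d≤k : suc d′ ≤ k
    d≤k with proj₁ md
    ... | M , N , _ , _ , _ , rank≥d , _ = rank≤k (M -M N) (suc d′) rank≥d

    open TailCode d′ (ℕP.≤-trans (ℕP.n≤1+n d′) d≤k)

    size : length C ≡ (q ^ m) ^ (k ∸ d′)
    size = begin
      length C                     ≡⟨ mrd (suc d′) md ⟩
      q ^ (m * (k ∸ suc d′ + 1))   ≡⟨ cong (λ e → q ^ (m * e)) block-count ⟩
      q ^ (m * (k ∸ d′))           ≡⟨ ℕP.^-*-assoc q m (k ∸ d′) ⟨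
      (q ^ m) ^ (k ∸ d′)           ∎
      where
        open ≡-Reasoning
        block-count : k ∸ suc d′ + 1 ≡ k ∸ d′
        block-count = trans (ℕP.+-comm (k ∸ suc d′) 1) (sym (ℕP.+-∸-assoc 1 d≤k))

    -- Distinct codewords differ in their last k − d′ rows, since their
    -- distance exceeds d′.
    tailCode-injective : Counting.InjectiveOn tailCode C
    tailCode-injective {M} {N} M∈C N∈C e with M ≟M N
    ... | yes M≡N = M≡N
    ... | no  M≢N = ⊥-elim (ℕP.1+n≰n (agree⇒rank≤ d′ M N (suc d′) (tailCode-agree M N e) (proj₂ md M N M∈C N∈C M≢N)))

    -- By counting, C is systematic on the last k − d′ rows: every matrix
    -- agrees from row d′ on with some codeword.
    systematic : ∀ X → ∃[ M ] (M ∈ C × AgreeFrom d′ X M)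
    systematic X with Counting.full⇒onto tailCode uC tailCode-injective size X
    ... | M , M∈C , e = M , M∈C , tailCode-agree X M (sym e)

    covers : Covers C d′
    covers X with systematic X
    ... | M , M∈C , agree = M , M∈C , agree⇒close d′ X M agree

    -- Every strictly larger code has distance ≤ d′: a new word is within d′
    -- of its systematic codeword.
    superset-distance≤ : ∀ D dD → StrictSuper D C → MinDist D dD → dD ≤ d′
    superset-distance≤ D dD (_ , C⊆D , X , X∈D , X∉C) (_ , sepD) with systematic X
    ... | M , M∈C , agree = agree⇒rank≤ d′ X M dD agree (sepD X M X∈D (C⊆D M M∈C) (λ { refl → X∉C M∈C }))

    -- For d′ = 0 agreement from row 0 is equality, so C is everything.
    d′≡0⇒whole : d′ ≡ 0 → IsWholeSpace C
    d′≡0⇒whole d′≡0 X with systematic X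
    ... | M , M∈C , agree = subst (_∈ C) (sym (vec-ext X M (λ i → agree i (subst (_≤ toℕ i) (sym d′≡0) z≤n)))) M∈C

    -- The whole space contains two matrices at distance 1, so then d′ = 0.
    whole⇒d′≡0 : 1 ≤ k → 1 ≤ m → IsWholeSpace C → d′ ≡ 0
    whole⇒d′≡0 1≤k 1≤m whole =
      let (Y , Y≢O , agree) = flip-first-entry 1≤k 1≤m O
      in ℕP.n≤0⇒n≡0 (ℕP.≤-pred (agree⇒rank≤ 1 Y O (suc d′) agree (proj₂ md Y O (whole Y) (whole O) Y≢O)))
      where
        O : Mat
        O = replicate k zeroRow

    module RadiusAndDegree (1≤k : 1 ≤ k) (1≤m : 1 ≤ m) {ρ μ : ℕ}
                           (radius : CovRadius C ρ) (maxdeg : MaxDeg C μ) where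

      ρ≤d′ : ρ ≤ d′
      ρ≤d′ = proj₂ radius d′ covers

      -- Unless C is the whole space, μ is attained by a proper extension,
      -- whose distance is ≤ d′; hence μ ≥ 1.
      μ≥1 : ¬ IsWholeSpace C → 1 ≤ μ
      μ≥1 ¬whole with proj₁ (proj₂ maxdeg ¬whole (suc d′) md)
      ... | D , dD , sup , mdD , μ≡ = subst (1 ≤_) (sym μ≡) (ℕP.m<n⇒0<n∸m (s≤s (superset-distance≤ D dD sup mdD)))

      μ≤1 : ¬ IsWholeSpace C → ∀ D → StrictSuper D C → MinDist D d′ → μ ≤ 1
      μ≤1 ¬whole D sup mdD = subst (μ ≤_) (ℕP.m+n∸n≡m 1 d′) (proj₂ (proj₂ maxdeg ¬whole (suc d′) md) D d′ sup mdD)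

      -- If ρ = d′ = e + 1, some word lies at distance ≥ d′ from C, and
      -- adjoining it gives a proper extension of distance exactly d′.
      tight⇒extension : ∀ e → d′ ≡ suc e → ρ ≡ d′ → ¬ ¬ (∃[ D ] (StrictSuper D C × MinDist D d′))
      tight⇒extension e refl ρ≡d′ = ¬¬-map extend (uncovered-word C e ¬covers)
        where
          ¬covers : ¬ Covers C e
          ¬covers covers-e = ℕP.1+n≰n (subst (_≤ e) ρ≡d′ (proj₂ radius e covers-e))
          extend : ∃[ X ] FarFrom C X d′ → ∃[ D ] (StrictSuper D C × MinDist D d′)
          extend (X , far) = X ∷ₗ C , extension , attained , separated
            where
              X∉C : X ∉ C
              X∉C X∈C = ℕP.n≮0 (agree⇒rank≤ 0 X X (suc e) (λ _ _ → refl) (far X X∈C))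
              X≢ : ∀ {M} → M ∈ C → X ≢ M
              X≢ M∈C refl = X∉C M∈C
              extension : StrictSuper (X ∷ₗ C) C
              extension = (All.tabulate X≢ ∷ uC , s≤s z≤n) , (λ _ → there) , X , here refl , X∉C
              separated : Separated (X ∷ₗ C) (suc e)
              separated = adjoin-far C X (suc e) (λ A B A∈ B∈ A≢B → rank-pred (A -M B) (suc e) (proj₂ md A B A∈ B∈ A≢B)) far
              attained : ∃[ A ] ∃[ B ] (A ∈ X ∷ₗ C × B ∈ X ∷ₗ C × A ≢ B × IsRank (A -M B) (suc e))
              attained =
                let (M , M∈C , close) = covers X
                in X , M , here refl , there M∈C , X≢ M∈C , far M M∈C , close

      -- ρ = d′ ⇒ μ = 1.  For d′ = 0, C is everything.  Otherwise, since
      -- μ ≡ 1 is decidable, we may reason under ¬¬: either C is everything,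
      -- or the extension of distance d′ gives 1 ≤ μ ≤ 1.
      tight⇒μ≡1 : ρ ≡ d′ → μ ≡ 1
      tight⇒μ≡1 = by-cases d′ refl
        where
          by-cases : ∀ n → d′ ≡ n → ρ ≡ d′ → μ ≡ 1
          by-cases zero    d′≡0 _    = proj₁ maxdeg (d′≡0⇒whole d′≡0)
          by-cases (suc e) d′≡   ρ≡d′ = decidable-stable (μ ℕ.≟ 1) λ μ≢1 → ¬¬-excluded-middle λ
            { (yes whole) → μ≢1 (proj₁ maxdeg whole)
            ; (no ¬whole) → tight⇒extension e d′≡ ρ≡d′ λ (D , sup , mdD) →
                μ≢1 (ℕP.≤-antisym (μ≤1 ¬whole D sup mdD) (μ≥1 ¬whole)) }

      -- If μ = 1 and C is not everything, some proper extension has distance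
      -- d′; its new word is at distance ≥ d′ from C, so ρ ≥ d′.
      μ≡1⇒d′≤ρ : μ ≡ 1 → ¬ IsWholeSpace C → d′ ≤ ρ
      μ≡1⇒d′≤ρ μ≡1 ¬whole with proj₁ (proj₂ maxdeg ¬whole (suc d′) md)
      ... | D , dD , sup@(_ , C⊆D , X , X∈D , X∉C) , mdD@(_ , sepD) , μ≡ = ℕP.≤-trans d′≤dD dD≤ρ
        where
          dD≤d′ : dD ≤ d′
          dD≤d′ = superset-distance≤ D dD sup mdD
          d′≤dD : d′ ≤ dD
          d′≤dD = ℕP.m∸n≡0⇒m≤n (ℕP.suc-injective (begin
            suc (d′ ∸ dD)  ≡⟨ ℕP.+-∸-assoc 1 dD≤d′ ⟨
            suc d′ ∸ dD    ≡⟨ μ≡ ⟨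
            μ              ≡⟨ μ≡1 ⟩
            1              ∎))
            where open ≡-Reasoning
          far : FarFrom C X dD
          far M M∈C = sepD X M X∈D (C⊆D M M∈C) (λ { refl → X∉C M∈C })
          dD≤ρ : dD ≤ ρ
          dD≤ρ = far⇒≤radius C X dD ρ far (proj₁ radius)

      -- μ = 1 ⇒ ρ = d′, again by cases (under ¬¬) on whether C is everything;
      -- if it is, then d′ = 0 and ρ ≤ d′ forces ρ = d′.
      μ≡1⇒tight : μ ≡ 1 → ρ ≡ d′
      μ≡1⇒tight μ≡1 = decidable-stable (ρ ℕ.≟ d′) λ ρ≢d′ → ¬¬-excluded-middle λ
        { (yes whole) → ρ≢d′ (ℕP.≤-antisym ρ≤d′ (subst (_≤ ρ) (sym (whole⇒d′≡0 1≤k 1≤m whole)) z≤n))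
        ; (no ¬whole) → ρ≢d′ (ℕP.≤-antisym ρ≤d′ (μ≡1⇒d′≤ρ μ≡1 ¬whole)) }

corollary6p1 : (q : ℕ) → IsPrimePower q → (F : FiniteField q) →
    (k m : ℕ) → 1 ≤ k → k ≤ m →
    let open RankMetric F k m in
    (C : List Mat) → IsCode C → IsMRD≥2 C →
    (d ρ μ : ℕ) → MinDist C d → CovRadius C ρ → MaxDeg C μ →
    (ρ ≤ d ∸ 1) × ((ρ ≡ d ∸ 1) ⇔ (μ ≡ 1))
corollary6p1 q _ F k m 1≤k k≤m C code mrd zero ρ μ md _ _ =
  ⊥-elim (Rank.MRD-distance-positive F k m (ℕP.≤-trans 1≤k k≤m) C code mrd md)
corollary6p1 q _ F k m 1≤k k≤m C (uC , _) (_ , mrd) (suc d′) ρ μ md radius maxdeg =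
  ρ≤d′ , mk⇔ tight⇒μ≡1 μ≡1⇒tight
  where
    open Rank F k m
    open MRD C uC mrd d′ md
    open RadiusAndDegree 1≤k (ℕP.≤-trans 1≤k k≤m) radius maxdeg
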